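{- Let $u$ be a cyclic binary word of length $n$ and let $S$ be the set of its subwords of length at most $\frac34n+4$. Then $n_{0,u}$, $n_{1,u}$ and $l_u$ can be recovered from $S$ and $n$; that is, if $v$ is any cyclic binary word of length $n$ whose set of subwords of length at most $\frac34 n+4$ equals $S$, then $n_{0,v}=n_{0,u}$, $n_{1,v}=n_{1,u}$ and $l_v=l_u$.
   Context: The alphabet is $\{0,1\}$. A cyclic word is an equivalence class of finite words under conjugacy; its length is that of a representative. If a cyclic word $w$ has representative $w_1\cdots w_n$, a subword of $w$ is any cyclic word with a representative $w_{i_1}\cdots w_{i_k}$, $1\le i_1<\dots<i_k\le n$. For a cyclic word $w$: $n_{0,w}$ and $n_{1,w}$ are the numbers of 0's and 1's in $w$; a block of 0's is a maximal cyclically-consecutive run of 0's, bounded by 1's on both sides (blocks of 1's analogously); $l_w$ is the number of blocks of 0's of $w$ (equal to the number of blocks of 1's). -}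

module Defs where

open import Data.Bool using (Bool; true; false)
open import Data.Nat using (ℕ; zero; suc; _+_; _*_; _≤_)
open import Data.List using (List; []; _∷_; _++_; [_]; length)
open import Data.Product using (Σ; _×_; _,_; ∃₂)
open import Relation.Binary.PropositionalEquality using (_≡_)
open import Data.List.Relation.Binary.Sublist.Propositional using (_⊆_)

-- Binary letters: 0 is false, 1 is true.
-- A cyclic word is represented by any of its representatives (a List Bool);
-- all notions below are invariant under conjugacy.

_∼_ : List Bool → List Bool → Set
x ∼ y = ∃₂ λ a b → (x ≡ a ++ b) × (y ≡ b ++ a)

-- The cyclic word [x] is a subword of the cyclic word [w]:
-- x is conjugate to a (scattered) subsequence w_{i1}...w_{ik} of w.
CycSubword : List Bool → List Bool → Set
CycSubword x w = Σ (List Bool) λ s → (s ⊆ w) × (x ∼ s)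

n0 : List Bool → ℕ
n0 [] = 0
n0 (false ∷ w) = suc (n0 w)
n0 (true ∷ w) = n0 w

n1 : List Bool → ℕ
n1 [] = 0
n1 (true ∷ w) = suc (n1 w)
n1 (false ∷ w) = n1 w

rot1 : List Bool → List Bool
rot1 [] = []
rot1 (x ∷ xs) = xs ++ [ x ]

count01 : List Bool → List Bool → ℕ
count01 (false ∷ xs) (true ∷ ys) = suc (count01 xs ys)
count01 (_ ∷ xs) (_ ∷ ys) = count01 xs ys
count01 _ _ = 0

-- l_w: number of blocks of 0's of the cyclic word w (each maximal cyclic run of
-- 0's bounded by 1's is counted via its right end, i.e. a cyclic factor 01).
blocks : List Bool → ℕ
blocks w = count01 w (rot1 w)

-- the set of cyclic subwords of w of length at most 3n/4 + 4 (i.e. 4k ≤ 3n + 16)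
-- agree for u and v
SameShortSubwords : ℕ → List Bool → List Bool → Set
SameShortSubwords n u v =
  (x : List Bool) → 4 * length x ≤ 3 * n + 16 →
  (CycSubword x u → CycSubword x v) × (CycSubword x v → CycSubword x u)

-- Letters: if v had more 0's than u, then either 0^(n0 u + 1) is short, and it is a
-- subword of v but not of u, or u has so many 0's that 1^(n1 v + 1) is short, and it
-- is a subword of u but not of v.
--
-- Blocks: l_w is the number of cyclic factors 01 of w. Passing to a subword never
-- increases it and decreases it by at most one per deleted letter. If l_v > l_u,
-- either (01)^(l_u + 1) is short, and it is a subword of v but not of u, or u has more
-- than (3n + 8)/8 blocks. In the latter case greedily deleting letters isolated between
-- two equal letters (each deletion merges two blocks) yields a short subword x of u with
-- l_x = l_u − (n − |x|); as x is also a subword of v, l_v ≤ l_x + (n − |x|) = l_u.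
module Submission where

open import Defs
open import Data.Bool using (Bool; true; false; not; T)
open import Data.Bool.Properties using (not-involutive)
open import Data.Nat using (ℕ; zero; suc; _+_; _*_; _≤_; _<_; _≤ᵇ_; z≤n; s≤s; _≤?_)
open import Data.Nat.Properties
open import Data.Nat.Tactic.RingSolver using (solve-∀)
open import Algebra.Properties.CommutativeSemigroup +-commutativeSemigroup using (x∙yz≈y∙xz)
open import Data.List using (List; []; _∷_; _++_; [_]; length; replicate)
open import Data.List.Properties using (length-++; ++-assoc; ++-identityʳ; length-replicate)
open import Data.List.Relation.Binary.Sublist.Propositional using (_⊆_; []; _∷_; _∷ʳ_; minimum; ⊆-refl)
open import Data.List.Relation.Binary.Sublist.Propositional.Properties using (++⁺ʳ)
open import Data.Product using (_×_; _,_; proj₁; proj₂; swap)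
open import Relation.Binary.PropositionalEquality using (_≡_; refl; sym; trans; cong; cong₂; subst; module ≡-Reasoning)
open import Relation.Nullary using (yes; no)

≤-by-evaluation : ∀ {m n} {m≤ᵇn : T (m ≤ᵇ n)} → m ≤ n
≤-by-evaluation {m} {n} {m≤ᵇn} = ≤ᵇ⇒≤ m n m≤ᵇn

additive⇒conj-invariant : (f : List Bool → ℕ) → (∀ x y → f (x ++ y) ≡ f x + f y) →
  ∀ x y → f (x ++ y) ≡ f (y ++ x)
additive⇒conj-invariant f f-++ x y = trans (f-++ x y) (trans (+-comm (f x) (f y)) (sym (f-++ y x)))

length-conj : ∀ (x y : List Bool) → length (x ++ y) ≡ length (y ++ x)
length-conj = additive⇒conj-invariant length (λ x y → length-++ x)

⊆⇒CycSubword : ∀ {s w} → s ⊆ w → CycSubword s w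
⊆⇒CycSubword {s} s⊆w = s , s⊆w , [] , s , refl , sym (++-identityʳ s)

CycSubword-mono : (f : List Bool → ℕ) → (∀ x y → f (x ++ y) ≡ f (y ++ x)) →
  (∀ {s w} → s ⊆ w → f s ≤ f w) → ∀ {x w} → CycSubword x w → f x ≤ f w
CycSubword-mono f f-conj f-mono (s , s⊆w , a , b , refl , refl) =
  ≤-trans (≤-reflexive (f-conj a b)) (f-mono s⊆w)

-- Letter counts

δ : Bool → Bool → ℕ
δ false false = 1
δ true true = 1
δ _ _ = 0

occ : Bool → List Bool → ℕ
occ b [] = 0
occ b (a ∷ w) = δ a b + occ b w

n0≡occ : ∀ w → n0 w ≡ occ false w
n0≡occ [] = refl
n0≡occ (false ∷ w) = cong suc (n0≡occ w)
n0≡occ (true ∷ w) = n0≡occ w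

n1≡occ : ∀ w → n1 w ≡ occ true w
n1≡occ [] = refl
n1≡occ (true ∷ w) = cong suc (n1≡occ w)
n1≡occ (false ∷ w) = n1≡occ w

occ-++ : ∀ b x y → occ b (x ++ y) ≡ occ b x + occ b y
occ-++ b [] y = refl
occ-++ b (a ∷ x) y = trans (cong (δ a b +_) (occ-++ b x y)) (sym (+-assoc (δ a b) (occ b x) (occ b y)))

occ-mono : ∀ b {s w} → s ⊆ w → occ b s ≤ occ b w
occ-mono b [] = ≤-refl
occ-mono b (y ∷ʳ s⊆w) = ≤-trans (occ-mono b s⊆w) (m≤n+m _ (δ y b))
occ-mono b (_∷_ {x = a} refl s⊆w) = +-monoʳ-≤ (δ a b) (occ-mono b s⊆w)

occ-complement : ∀ b w → occ b w + occ (not b) w ≡ length w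
occ-complement b [] = refl
occ-complement b (a ∷ w) = begin
  (δ a b + occ b w) + (δ a (not b) + occ (not b) w)
    ≡⟨ interchange (δ a b) (occ b w) (δ a (not b)) (occ (not b) w) ⟩
  (δ a b + δ a (not b)) + (occ b w + occ (not b) w)
    ≡⟨ cong₂ _+_ (δ-complement a b) (occ-complement b w) ⟩
  suc (length w) ∎
  where
  open ≡-Reasoning
  interchange : ∀ x X y Y → (x + X) + (y + Y) ≡ (x + y) + (X + Y)
  interchange = solve-∀
  δ-complement : ∀ a b → δ a b + δ a (not b) ≡ 1
  δ-complement false false = refl
  δ-complement false true = refl
  δ-complement true false = refl
  δ-complement true true = refl

replicate-⊆ : ∀ b k w → k ≤ occ b w → replicate k b ⊆ w
replicate-⊆ b zero w _ = minimum w
replicate-⊆ false (suc k) (false ∷ w) (s≤s k≤) = refl ∷ replicate-⊆ false k w k≤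
replicate-⊆ true (suc k) (true ∷ w) (s≤s k≤) = refl ∷ replicate-⊆ true k w k≤
replicate-⊆ false (suc k) (true ∷ w) k≤ = true ∷ʳ replicate-⊆ false (suc k) w k≤
replicate-⊆ true (suc k) (false ∷ w) k≤ = false ∷ʳ replicate-⊆ true (suc k) w k≤

occ-replicate : ∀ b k → occ b (replicate k b) ≡ k
occ-replicate b zero = refl
occ-replicate false (suc k) = cong suc (occ-replicate false k)
occ-replicate true (suc k) = cong suc (occ-replicate true k)

-- Blocks as cyclic factors 01

rise : Bool → Bool → ℕ
rise false true = 1
rise _ _ = 0

rises : Bool → List Bool → Bool → ℕ
rises p [] q = rise p q
rises p (a ∷ r) q = rise p a + rises a r q

cyclicRises : List Bool → ℕ
cyclicRises [] = 0
cyclicRises (c ∷ r) = rises c r c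

count01-rises : ∀ p r q → count01 (p ∷ r) (r ++ [ q ]) ≡ rises p r q
count01-rises false [] false = refl
count01-rises false [] true = refl
count01-rises true [] false = refl
count01-rises true [] true = refl
count01-rises false (false ∷ r) q = count01-rises false r q
count01-rises false (true ∷ r) q = cong suc (count01-rises true r q)
count01-rises true (a ∷ r) q = count01-rises a r q

blocks≡cyclicRises : ∀ w → blocks w ≡ cyclicRises w
blocks≡cyclicRises [] = refl
blocks≡cyclicRises (c ∷ r) = count01-rises c r c

rises-∷ʳ : ∀ p r c q → rises p (r ++ [ c ]) q ≡ rises p r c + rise c q
rises-∷ʳ p [] c q = refl
rises-∷ʳ p (a ∷ r) c q =
  trans (cong (rise p a +_) (rises-∷ʳ a r c q)) (sym (+-assoc (rise p a) (rises a r c) (rise c q)))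

cyclicRises-rotate : ∀ c r → cyclicRises (r ++ [ c ]) ≡ cyclicRises (c ∷ r)
cyclicRises-rotate c [] = refl
cyclicRises-rotate c (d ∷ r) = trans (rises-∷ʳ d r c d) (+-comm (rises d r c) (rise c d))

cyclicRises-conj : ∀ x y → cyclicRises (x ++ y) ≡ cyclicRises (y ++ x)
cyclicRises-conj [] y = cong cyclicRises (sym (++-identityʳ y))
cyclicRises-conj (c ∷ x) y = begin
  cyclicRises (c ∷ (x ++ y))       ≡⟨ sym (cyclicRises-rotate c (x ++ y)) ⟩
  cyclicRises ((x ++ y) ++ [ c ])  ≡⟨ cong cyclicRises (++-assoc x y [ c ]) ⟩
  cyclicRises (x ++ (y ++ [ c ]))  ≡⟨ cyclicRises-conj x (y ++ [ c ]) ⟩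
  cyclicRises ((y ++ [ c ]) ++ x)  ≡⟨ cong cyclicRises (++-assoc y [ c ] x) ⟩
  cyclicRises (y ++ (c ∷ x))       ∎
  where open ≡-Reasoning

-- Blocks of subwords

rise-triangle : ∀ p y q → rise p q ≤ rise p y + rise y q
rise-triangle false false false = ≤-by-evaluation
rise-triangle false false true = ≤-by-evaluation
rise-triangle false true false = ≤-by-evaluation
rise-triangle false true true = ≤-by-evaluation
rise-triangle true false false = ≤-by-evaluation
rise-triangle true false true = ≤-by-evaluation
rise-triangle true true false = ≤-by-evaluation
rise-triangle true true true = ≤-by-evaluation

rise-detour : ∀ p y q → rise p y + rise y q ≤ suc (rise p q)
rise-detour false false false = ≤-by-evaluation
rise-detour false false true = ≤-by-evaluation
rise-detour false true false = ≤-by-evaluation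
rise-detour false true true = ≤-by-evaluation
rise-detour true false false = ≤-by-evaluation
rise-detour true false true = ≤-by-evaluation
rise-detour true true false = ≤-by-evaluation
rise-detour true true true = ≤-by-evaluation

rises-∷-≥ : ∀ p y r q → rises p r q ≤ rises p (y ∷ r) q
rises-∷-≥ p y [] q = rise-triangle p y q
rises-∷-≥ p y (a ∷ r) q =
  ≤-trans (+-monoˡ-≤ (rises a r q) (rise-triangle p y a))
          (≤-reflexive (+-assoc (rise p y) (rise y a) (rises a r q)))

rises-∷-≤ : ∀ p y r q → rises p (y ∷ r) q ≤ suc (rises p r q)
rises-∷-≤ p y [] q = rise-detour p y q
rises-∷-≤ p y (a ∷ r) q =
  ≤-trans (≤-reflexive (sym (+-assoc (rise p y) (rise y a) (rises a r q))))
          (+-monoˡ-≤ (rises a r q) (rise-detour p y a))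

rises-mono : ∀ {s w} → s ⊆ w → ∀ p q → rises p s q ≤ rises p w q
rises-mono [] p q = ≤-refl
rises-mono {w = y ∷ w} (y ∷ʳ s⊆w) p q = ≤-trans (rises-mono s⊆w p q) (rises-∷-≥ p y w q)
rises-mono (_∷_ {x = a} refl s⊆w) p q = +-monoʳ-≤ (rise p a) (rises-mono s⊆w a q)

rises-deletion : ∀ {s w} → s ⊆ w → ∀ p q → length s + rises p w q ≤ length w + rises p s q
rises-deletion [] p q = ≤-refl
rises-deletion {s} {y ∷ w} (y ∷ʳ s⊆w) p q = begin
  length s + rises p (y ∷ w) q    ≤⟨ +-monoʳ-≤ (length s) (rises-∷-≤ p y w q) ⟩
  length s + suc (rises p w q)    ≡⟨ +-suc (length s) (rises p w q) ⟩
  suc (length s + rises p w q)    ≤⟨ s≤s (rises-deletion s⊆w p q) ⟩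
  suc (length w + rises p s q)    ∎
  where open ≤-Reasoning
rises-deletion {a ∷ s} {a ∷ w} (refl ∷ s⊆w) p q = s≤s (begin
  length s + (rise p a + rises a w q)  ≡⟨ x∙yz≈y∙xz (length s) (rise p a) (rises a w q) ⟩
  rise p a + (length s + rises a w q)  ≤⟨ +-monoʳ-≤ (rise p a) (rises-deletion s⊆w a q) ⟩
  rise p a + (length w + rises a s q)  ≡⟨ x∙yz≈y∙xz (rise p a) (length w) (rises a s q) ⟩
  length w + (rise p a + rises a s q)  ∎)
  where open ≤-Reasoning

⊆-∷ʳ : ∀ (s : List Bool) y → s ⊆ s ++ [ y ]
⊆-∷ʳ s y = ++⁺ʳ [ y ] ⊆-refl

cyclicRises-∷-≥ : ∀ y s → cyclicRises s ≤ cyclicRises (y ∷ s)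
cyclicRises-∷-≥ y [] = z≤n
cyclicRises-∷-≥ y (a ∷ s) = begin
  rises a s a               ≤⟨ rises-mono (⊆-∷ʳ s y) a a ⟩
  rises a (s ++ [ y ]) a    ≡⟨ cyclicRises-rotate y (a ∷ s) ⟩
  cyclicRises (y ∷ a ∷ s)   ∎
  where open ≤-Reasoning

cyclicRises-∷-≤ : ∀ y s → cyclicRises (y ∷ s) ≤ suc (cyclicRises s)
cyclicRises-∷-≤ false [] = z≤n
cyclicRises-∷-≤ true [] = z≤n
cyclicRises-∷-≤ y (a ∷ s) = +-cancelˡ-≤ (length s) _ _ (begin
  length s + cyclicRises (y ∷ a ∷ s)  ≡⟨ cong (length s +_) (sym (cyclicRises-rotate y (a ∷ s))) ⟩
  length s + rises a (s ++ [ y ]) a   ≤⟨ rises-deletion (⊆-∷ʳ s y) a a ⟩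
  length (s ++ [ y ]) + rises a s a   ≡⟨ cong (_+ rises a s a) (length-++ s) ⟩
  length s + 1 + rises a s a          ≡⟨ +-assoc (length s) 1 (rises a s a) ⟩
  length s + suc (rises a s a)        ∎)
  where open ≤-Reasoning

cyclicRises-⊆-mono : ∀ {s w} → s ⊆ w → cyclicRises s ≤ cyclicRises w
cyclicRises-⊆-mono [] = ≤-refl
cyclicRises-⊆-mono {s} (y ∷ʳ s⊆w) = ≤-trans (cyclicRises-∷-≥ y s) (rises-mono s⊆w y y)
cyclicRises-⊆-mono (_∷_ {x = a} refl s⊆w) = rises-mono s⊆w a a

cyclicRises-⊆-deletion : ∀ {s w} → s ⊆ w → length s + cyclicRises w ≤ length w + cyclicRises s
cyclicRises-⊆-deletion [] = ≤-refl
cyclicRises-⊆-deletion {s} {y ∷ w} (y ∷ʳ s⊆w) = begin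
  length s + rises y w y              ≤⟨ rises-deletion s⊆w y y ⟩
  length w + cyclicRises (y ∷ s)      ≤⟨ +-monoʳ-≤ (length w) (cyclicRises-∷-≤ y s) ⟩
  length w + suc (cyclicRises s)      ≡⟨ +-suc (length w) (cyclicRises s) ⟩
  suc (length w + cyclicRises s)      ∎
  where open ≤-Reasoning
cyclicRises-⊆-deletion (_∷_ {x = a} refl s⊆w) = s≤s (rises-deletion s⊆w a a)

cyclicRises-mono : ∀ {x w} → CycSubword x w → cyclicRises x ≤ cyclicRises w
cyclicRises-mono = CycSubword-mono cyclicRises cyclicRises-conj cyclicRises-⊆-mono

cyclicRises-deletion : ∀ {x w} → CycSubword x w → length x + cyclicRises w ≤ length w + cyclicRises x
cyclicRises-deletion (s , s⊆w , a , b , refl , refl)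
  rewrite length-conj a b | cyclicRises-conj a b = cyclicRises-⊆-deletion s⊆w

-- Alternating subwords

alternating : Bool → ℕ → List Bool
alternating c zero = []
alternating c (suc m) = c ∷ alternating (not c) m

length-alternating : ∀ c m → length (alternating c m) ≡ m
length-alternating c zero = refl
length-alternating c (suc m) = cong suc (length-alternating (not c) m)

alternating-2+ : ∀ c m → alternating c (2 + m) ≡ c ∷ not c ∷ alternating c m
alternating-2+ c m = cong (λ d → c ∷ not c ∷ alternating d m) (not-involutive c)

rises-alternating : ∀ c k q → rises (not c) (alternating c (2 * k)) q ≡ k + rise (not c) q
rises-alternating c zero q = refl
rises-alternating c (suc k) q = begin
  rises (not c) (alternating c (2 * suc k)) q
    ≡⟨ cong (λ w → rises (not c) w q) (trans (cong (alternating c) (*-suc 2 k)) (alternating-2+ c (2 * k))) ⟩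
  rise (not c) c + (rise c (not c) + rises (not c) (alternating c (2 * k)) q)
    ≡⟨ rise-there-and-back c _ ⟩
  suc (rises (not c) (alternating c (2 * k)) q)
    ≡⟨ cong suc (rises-alternating c k q) ⟩
  suc (k + rise (not c) q) ∎
  where
  open ≡-Reasoning
  rise-there-and-back : ∀ c x → rise (not c) c + (rise c (not c) + x) ≡ suc x
  rise-there-and-back false x = refl
  rise-there-and-back true x = refl

cyclicRises-alternating : ∀ c k → cyclicRises (alternating c (2 * k)) ≡ k
cyclicRises-alternating c zero = refl
cyclicRises-alternating c (suc k) = begin
  cyclicRises (alternating c (2 * suc k))
    ≡⟨ cong cyclicRises (trans (cong (alternating c) (*-suc 2 k)) (alternating-2+ c (2 * k))) ⟩
  rise c (not c) + rises (not c) (alternating c (2 * k)) c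
    ≡⟨ cong (rise c (not c) +_) (rises-alternating c k c) ⟩
  rise c (not c) + (k + rise (not c) c)
    ≡⟨ rise-round-trip c k ⟩
  suc k ∎
  where
  open ≡-Reasoning
  rise-round-trip : ∀ c k → rise c (not c) + (k + rise (not c) c) ≡ suc k
  rise-round-trip false k = cong suc (+-identityʳ k)
  rise-round-trip true k = +-comm k 1

changes : Bool → List Bool → ℕ
changes p [] = 0
changes p (a ∷ r) = rise p a + rise a p + changes a r

alternating-⊆ : ∀ p r m → m ≤ changes p r → alternating (not p) m ⊆ r
alternating-⊆ p r zero _ = minimum r
alternating-⊆ false (false ∷ r) (suc m) m≤ = false ∷ʳ alternating-⊆ false r (suc m) m≤
alternating-⊆ false (true ∷ r) (suc m) (s≤s m≤) = refl ∷ alternating-⊆ true r m m≤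
alternating-⊆ true (true ∷ r) (suc m) m≤ = true ∷ʳ alternating-⊆ true r (suc m) m≤
alternating-⊆ true (false ∷ r) (suc m) (s≤s m≤) = refl ∷ alternating-⊆ false r m m≤

-- Rises and falls alternate along p r q; δ _ true records which of the two comes first.
rises-≤-changes : ∀ p r q → 2 * rises p r q + δ p true ≤ suc (changes p r + δ q true)
rises-≤-changes false [] false = ≤-by-evaluation
rises-≤-changes false [] true = ≤-by-evaluation
rises-≤-changes true [] false = ≤-by-evaluation
rises-≤-changes true [] true = ≤-by-evaluation
rises-≤-changes p (a ∷ r) q = +-cancelʳ-≤ (δ a true) _ _ (begin
  2 * (rise p a + rises a r q) + δ p true + δ a true
    ≡⟨ regroup (rise p a) (rises a r q) (δ p true) (δ a true) ⟩
  (2 * rise p a + δ p true) + (2 * rises a r q + δ a true)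
    ≤⟨ +-mono-≤ (rise-≤-change p a) (rises-≤-changes a r q) ⟩
  (rise p a + rise a p + δ a true) + suc (changes a r + δ q true)
    ≡⟨ regroup′ (rise p a + rise a p) (δ a true) (changes a r) (δ q true) ⟩
  suc (rise p a + rise a p + changes a r + δ q true) + δ a true ∎)
  where
  open ≤-Reasoning
  regroup : ∀ x X y z → 2 * (x + X) + y + z ≡ (2 * x + y) + (2 * X + z)
  regroup = solve-∀
  regroup′ : ∀ d y C z → (d + y) + suc (C + z) ≡ suc (d + C + z) + y
  regroup′ = solve-∀
  rise-≤-change : ∀ p a → 2 * rise p a + δ p true ≤ rise p a + rise a p + δ a true
  rise-≤-change false false = ≤-by-evaluation
  rise-≤-change false true = ≤-by-evaluation
  rise-≤-change true false = ≤-by-evaluation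
  rise-≤-change true true = ≤-by-evaluation

alternating-⊆-cyclic : ∀ c r k → suc k ≤ cyclicRises (c ∷ r) → alternating c (2 * suc k) ⊆ c ∷ r
alternating-⊆-cyclic c r k k<rises = refl ∷ alternating-⊆ c r _ (≤-pred (≤-trans (*-monoʳ-≤ 2 k<rises)
  (+-cancelʳ-≤ (δ c true) _ _ (rises-≤-changes c r c))))

-- Deleting isolated letters

isolated : Bool → Bool → Bool → Bool
isolated false true false = true
isolated true false true = true
isolated _ _ _ = false

next : List Bool → Bool → Bool
next [] q = q
next (b ∷ _) q = b

dropIsolated : Bool → List Bool → Bool → List Bool
dropIsolated p [] q = []
dropIsolated p (a ∷ r) q with isolated p a (next r q)
... | true = dropIsolated p r q
... | false = a ∷ dropIsolated a r q

dropIsolated-⊆ : ∀ p r q → dropIsolated p r q ⊆ r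
dropIsolated-⊆ p [] q = []
dropIsolated-⊆ p (a ∷ r) q with isolated p a (next r q)
... | true = a ∷ʳ dropIsolated-⊆ p r q
... | false = refl ∷ dropIsolated-⊆ a r q

isolated-rise : ∀ p a r q → isolated p a (next r q) ≡ true → rises p (a ∷ r) q ≡ suc (rises p r q)
isolated-rise false false r q ()
isolated-rise true true r q ()
isolated-rise false true [] false refl = refl
isolated-rise false true [] true ()
isolated-rise false true (false ∷ r) q refl = refl
isolated-rise false true (true ∷ r) q ()
isolated-rise true false [] true refl = refl
isolated-rise true false [] false ()
isolated-rise true false (true ∷ r) q refl = refl
isolated-rise true false (false ∷ r) q ()

dropIsolated-rises : ∀ p r q →
  length r + rises p (dropIsolated p r q) q ≡ length (dropIsolated p r q) + rises p r q
dropIsolated-rises p [] q = refl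
dropIsolated-rises p (a ∷ r) q with isolated p a (next r q) in isolated≡
... | true = begin
  suc (length r + rises p (dropIsolated p r q) q)  ≡⟨ cong suc (dropIsolated-rises p r q) ⟩
  suc (length kept + rises p r q)                  ≡⟨ sym (+-suc (length kept) (rises p r q)) ⟩
  length kept + suc (rises p r q)                  ≡⟨ cong (length kept +_) (sym (isolated-rise p a r q isolated≡)) ⟩
  length kept + rises p (a ∷ r) q                  ∎
  where
  open ≡-Reasoning
  kept = dropIsolated p r q
... | false = cong suc (begin
  length r + (rise p a + rises a kept q)  ≡⟨ x∙yz≈y∙xz (length r) (rise p a) (rises a kept q) ⟩
  rise p a + (length r + rises a kept q)  ≡⟨ cong (rise p a +_) (dropIsolated-rises a r q) ⟩
  rise p a + (length kept + rises a r q)  ≡⟨ x∙yz≈y∙xz (rise p a) (length kept) (rises a r q) ⟩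
  length kept + (rise p a + rises a r q)  ∎)
  where
  open ≡-Reasoning
  kept = dropIsolated a r q

-- Credit for the pending pair (last kept letter, next letter); the values make each
-- scanned letter cost at most 3 in potential-drop and potential-keep.
pairCredit : Bool → Bool → ℕ
pairCredit false false = 1
pairCredit false true = 0
pairCredit true false = 2
pairCredit true true = 3

potential : Bool → List Bool → Bool → ℕ
potential p r q = 4 * rises p r q + pairCredit p (next r q)

potential-[] : ∀ p q → potential p [] q ≤ 4
potential-[] false false = ≤-by-evaluation
potential-[] false true = ≤-by-evaluation
potential-[] true false = ≤-by-evaluation
potential-[] true true = ≤-by-evaluation

pairCredit-isolated : ∀ p a b → isolated p a b ≡ true → 4 + pairCredit p a ≡ 3 + pairCredit p b
pairCredit-isolated false false b ()
pairCredit-isolated true true b ()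
pairCredit-isolated false true false refl = refl
pairCredit-isolated false true true ()
pairCredit-isolated true false true refl = refl
pairCredit-isolated true false false ()

pairCredit-kept : ∀ p a b → isolated p a b ≡ false → 2 + 4 * rise p a + pairCredit p a ≤ 3 + pairCredit a b
pairCredit-kept false false false _ = ≤-by-evaluation
pairCredit-kept false false true _ = ≤-by-evaluation
pairCredit-kept false true false ()
pairCredit-kept false true true _ = ≤-by-evaluation
pairCredit-kept true false false _ = ≤-by-evaluation
pairCredit-kept true false true ()
pairCredit-kept true true false _ = ≤-by-evaluation
pairCredit-kept true true true _ = ≤-by-evaluation

potential-drop : ∀ p a r q → isolated p a (next r q) ≡ true → potential p (a ∷ r) q ≡ 3 + potential p r q
potential-drop p a r q isolated≡ = begin
  4 * rises p (a ∷ r) q + pairCredit p a    ≡⟨ cong (λ t → 4 * t + pairCredit p a) (isolated-rise p a r q isolated≡) ⟩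
  4 * suc (rises p r q) + pairCredit p a    ≡⟨ shift (rises p r q) (pairCredit p a) ⟩
  4 * rises p r q + (4 + pairCredit p a)    ≡⟨ cong (4 * rises p r q +_) (pairCredit-isolated p a (next r q) isolated≡) ⟩
  4 * rises p r q + (3 + pairCredit p (next r q))  ≡⟨ x∙yz≈y∙xz (4 * rises p r q) 3 _ ⟩
  3 + potential p r q                       ∎
  where
  open ≡-Reasoning
  shift : ∀ R x → 4 * suc R + x ≡ 4 * R + (4 + x)
  shift = solve-∀

potential-keep : ∀ p a r q → isolated p a (next r q) ≡ false → 2 + potential p (a ∷ r) q ≤ 3 + potential a r q
potential-keep p a r q isolated≡ = begin
  2 + (4 * (rise p a + rises a r q) + pairCredit p a)  ≡⟨ regroup (rise p a) (rises a r q) (pairCredit p a) ⟩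
  (2 + 4 * rise p a + pairCredit p a) + 4 * rises a r q
    ≤⟨ +-monoˡ-≤ (4 * rises a r q) (pairCredit-kept p a (next r q) isolated≡) ⟩
  (3 + pairCredit a (next r q)) + 4 * rises a r q     ≡⟨ regroup′ (pairCredit a (next r q)) (rises a r q) ⟩
  3 + potential a r q                                 ∎
  where
  open ≤-Reasoning
  regroup : ∀ x R k → 2 + (4 * (x + R) + k) ≡ (2 + 4 * x + k) + 4 * R
  regroup = solve-∀
  regroup′ : ∀ k R → (3 + k) + 4 * R ≡ 3 + (4 * R + k)
  regroup′ = solve-∀

charge-letter : ∀ {g W m} → g + W ≤ 3 * m + 4 → g + (3 + W) ≤ 3 * suc m + 4
charge-letter {g} {W} {m} g+W≤ = begin
  g + (3 + W)     ≡⟨ x∙yz≈y∙xz g 3 W ⟩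
  3 + (g + W)     ≤⟨ +-monoʳ-≤ 3 g+W≤ ⟩
  3 + (3 * m + 4) ≡⟨ move m ⟩
  3 * suc m + 4   ∎
  where
  open ≤-Reasoning
  move : ∀ m → 3 + (3 * m + 4) ≡ 3 * suc m + 4
  move = solve-∀

dropIsolated-length : ∀ p r q → 2 * length (dropIsolated p r q) + potential p r q ≤ 3 * length r + 4
dropIsolated-length p [] q = potential-[] p q
dropIsolated-length p (a ∷ r) q with isolated p a (next r q) in isolated≡
... | true = begin
  2 * length kept + potential p (a ∷ r) q  ≡⟨ cong (2 * length kept +_) (potential-drop p a r q isolated≡) ⟩
  2 * length kept + (3 + potential p r q)  ≤⟨ charge-letter (dropIsolated-length p r q) ⟩
  3 * suc (length r) + 4                   ∎
  where
  open ≤-Reasoning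
  kept = dropIsolated p r q
... | false = begin
  2 * suc (length kept) + potential p (a ∷ r) q  ≡⟨ regroup (length kept) (potential p (a ∷ r) q) ⟩
  2 * length kept + (2 + potential p (a ∷ r) q)  ≤⟨ +-monoʳ-≤ (2 * length kept) (potential-keep p a r q isolated≡) ⟩
  2 * length kept + (3 + potential a r q)        ≤⟨ charge-letter (dropIsolated-length a r q) ⟩
  3 * suc (length r) + 4                         ∎
  where
  open ≤-Reasoning
  kept = dropIsolated a r q
  regroup : ∀ g W → 2 * suc g + W ≡ 2 * g + (2 + W)
  regroup = solve-∀

thin : List Bool → List Bool
thin [] = []
thin (c ∷ r) = c ∷ dropIsolated c r c

thin-⊆ : ∀ w → thin w ⊆ w
thin-⊆ [] = []
thin-⊆ (c ∷ r) = refl ∷ dropIsolated-⊆ c r c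

thin-cyclicRises : ∀ w → length w + cyclicRises (thin w) ≡ length (thin w) + cyclicRises w
thin-cyclicRises [] = refl
thin-cyclicRises (c ∷ r) = cong suc (dropIsolated-rises c r c)

thin-length : ∀ w → 2 * length (thin w) + 4 * cyclicRises w ≤ 3 * length w + 3
thin-length [] = z≤n
thin-length (c ∷ r) = begin
  2 * suc (length kept) + 4 * rises c r c                          ≡⟨ regroup (length kept) (rises c r c) ⟩
  2 + (2 * length kept + 4 * rises c r c)                          ≤⟨ +-monoʳ-≤ 2 (m+n≤o⇒m≤o _ without-credit) ⟩
  2 + (3 * length r + 4)                                           ≡⟨ regroup′ (length r) ⟩
  3 * suc (length r) + 3                                           ∎
  where
  open ≤-Reasoning
  kept = dropIsolated c r c
  without-credit : (2 * length kept + 4 * rises c r c) + pairCredit c (next r c) ≤ 3 * length r + 4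
  without-credit = ≤-trans (≤-reflexive (+-assoc (2 * length kept) _ _)) (dropIsolated-length c r c)
  regroup : ∀ g R → 2 * suc g + 4 * R ≡ 2 + (2 * g + 4 * R)
  regroup = solve-∀
  regroup′ : ∀ m → 2 + (3 * m + 4) ≡ 3 * suc m + 3
  regroup′ = solve-∀

<-complement : ∀ {a c a′ c′} → a + c ≡ a′ + c′ → a < a′ → c′ < c
<-complement {a} {c} {a′} {c′} eq a<a′ = +-cancelˡ-< a c′ c (begin-strict
  a + c′   <⟨ +-monoˡ-< c′ a<a′ ⟩
  a′ + c′  ≡⟨ sym eq ⟩
  a + c    ∎)
  where open ≤-Reasoning

complement-short : ∀ a c {n} → a + c ≡ n → 3 * n + 16 < 4 * suc a → 4 * c ≤ 3 * n + 16
complement-short a c refl long = +-cancelʳ-≤ (suc X) (4 * c) X (begin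
  4 * c + suc X                          ≤⟨ +-monoʳ-≤ (4 * c) long ⟩
  4 * c + 4 * suc a                      ≡⟨ regroup a c ⟩
  4 * (a + c) + 4                        ≤⟨ m≤m+n _ (2 * (a + c) + 29) ⟩
  4 * (a + c) + 4 + (2 * (a + c) + 29)   ≡⟨ regroup′ (a + c) ⟩
  X + suc X                              ∎)
  where
  open ≤-Reasoning
  X = 3 * (a + c) + 16
  regroup : ∀ a c → 4 * c + 4 * suc a ≡ 4 * (a + c) + 4
  regroup = solve-∀
  regroup′ : ∀ m → 4 * m + 4 + (2 * m + 29) ≡ (3 * m + 16) + suc (3 * m + 16)
  regroup′ = solve-∀

thin-short : ∀ g l n → 2 * g + 4 * l ≤ 3 * n + 3 → 3 * n + 16 < 4 * (2 * suc l) → 4 * g ≤ 3 * n + 16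
thin-short g l n bound long = +-cancelʳ-≤ (3 * n + 9) (4 * g) (3 * n + 16) (begin
  4 * g + (3 * n + 9)             ≤⟨ +-monoʳ-≤ (4 * g) many-blocks ⟩
  4 * g + 8 * l                   ≡⟨ double g l ⟩
  2 * (2 * g + 4 * l)             ≤⟨ *-monoʳ-≤ 2 bound ⟩
  2 * (3 * n + 3)                 ≤⟨ m≤m+n _ 19 ⟩
  2 * (3 * n + 3) + 19            ≡⟨ split n ⟩
  3 * n + 16 + (3 * n + 9)        ∎)
  where
  open ≤-Reasoning
  double : ∀ g l → 4 * g + 8 * l ≡ 2 * (2 * g + 4 * l)
  double = solve-∀
  split : ∀ n → 2 * (3 * n + 3) + 19 ≡ 3 * n + 16 + (3 * n + 9)
  split = solve-∀
  shift : ∀ n → 3 * n + 9 + 8 ≡ suc (3 * n + 16)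
  shift = solve-∀
  octuple : ∀ l → 4 * (2 * suc l) ≡ 8 * l + 8
  octuple = solve-∀
  many-blocks : 3 * n + 9 ≤ 8 * l
  many-blocks = +-cancelʳ-≤ 8 (3 * n + 9) (8 * l)
    (≤-trans (≤-reflexive (shift n)) (≤-trans long (≤-reflexive (octuple l))))

-- Short subwords

ShortSubwords⊆ : ℕ → List Bool → List Bool → Set
ShortSubwords⊆ n w w′ = ∀ x → 4 * length x ≤ 3 * n + 16 → CycSubword x w → CycSubword x w′

SameShortSubwords⇒⊆ : ∀ {n u v} → SameShortSubwords n u v → ShortSubwords⊆ n u v
SameShortSubwords⇒⊆ same x short = proj₁ (same x short)

SameShortSubwords⇒⊇ : ∀ {n u v} → SameShortSubwords n u v → ShortSubwords⊆ n v u
SameShortSubwords⇒⊇ same x short = proj₂ (same x short)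

SameShortSubwords-sym : ∀ {n u v} → SameShortSubwords n u v → SameShortSubwords n v u
SameShortSubwords-sym same x short = swap (same x short)

occ-transfer : ∀ {n w w′} b k → ShortSubwords⊆ n w w′ → 4 * k ≤ 3 * n + 16 → k ≤ occ b w → k ≤ occ b w′
occ-transfer {n} {w} {w′} b k w⊆w′ short k≤occ = begin
  k                      ≡⟨ sym (occ-replicate b k) ⟩
  occ b (replicate k b)  ≤⟨ CycSubword-mono (occ b) (additive⇒conj-invariant (occ b) (occ-++ b)) (occ-mono b) power⊆w′ ⟩
  occ b w′               ∎
  where
  open ≤-Reasoning
  power⊆w′ : CycSubword (replicate k b) w′
  power⊆w′ = w⊆w′ (replicate k b) (subst (λ m → 4 * m ≤ 3 * n + 16) (sym (length-replicate k)) short)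
    (⊆⇒CycSubword (replicate-⊆ b k w k≤occ))

cyclicRises-transfer : ∀ {n w w′} k → ShortSubwords⊆ n w w′ → 4 * (2 * k) ≤ 3 * n + 16 →
  k ≤ cyclicRises w → k ≤ cyclicRises w′
cyclicRises-transfer zero _ _ _ = z≤n
cyclicRises-transfer {w = []} (suc k) _ _ ()
cyclicRises-transfer {n} {c ∷ r} {w′} (suc k) w⊆w′ short k≤rises = begin
  suc k                                    ≡⟨ sym (cyclicRises-alternating c (suc k)) ⟩
  cyclicRises (alternating c (2 * suc k))  ≤⟨ cyclicRises-mono alternation⊆w′ ⟩
  cyclicRises w′                           ∎
  where
  open ≤-Reasoning
  alternation⊆w′ : CycSubword (alternating c (2 * suc k)) w′
  alternation⊆w′ = w⊆w′ _
    (subst (λ m → 4 * m ≤ 3 * n + 16) (sym (length-alternating c (2 * suc k))) short)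
    (⊆⇒CycSubword (alternating-⊆-cyclic c r k k≤rises))

occ-≤ : ∀ b {n u v} → length u ≡ n → length v ≡ n → SameShortSubwords n u v → occ b v ≤ occ b u
occ-≤ b {n} {u} {v} |u|≡n |v|≡n same with 4 * suc (occ b u) ≤? 3 * n + 16
... | yes short = ≮⇒≥ λ u<v → n≮n _ (occ-transfer {n} b _ (SameShortSubwords⇒⊇ {n} same) short u<v)
... | no long = ≮⇒≥ λ u<v → n≮n _
  (occ-transfer {n} (not b) _ (SameShortSubwords⇒⊆ {n} same) (complement-short′ (v<u u<v)) (v<u u<v))
  where
  v<u : occ b u < occ b v → occ (not b) v < occ (not b) u
  v<u = <-complement (trans (occ-complement b u) (trans |u|≡n (sym (trans (occ-complement b v) |v|≡n))))
  complement-short′ : occ (not b) v < occ (not b) u → 4 * suc (occ (not b) v) ≤ 3 * n + 16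
  complement-short′ v<u = ≤-trans (*-monoʳ-≤ 4 v<u)
    (complement-short _ _ {n} (trans (occ-complement b u) |u|≡n) (≰⇒> long))

cyclicRises-≤ : ∀ {n u v} → length u ≡ n → length v ≡ n → SameShortSubwords n u v →
  cyclicRises v ≤ cyclicRises u
cyclicRises-≤ {n} {u} {v} |u|≡n |v|≡n same with 4 * (2 * suc (cyclicRises u)) ≤? 3 * n + 16
... | yes short = ≮⇒≥ λ u<v → n≮n _ (cyclicRises-transfer {n} _ (SameShortSubwords⇒⊇ {n} same) short u<v)
... | no long = +-cancelˡ-≤ (length x) _ _ (begin
  length x + cyclicRises v  ≤⟨ cyclicRises-deletion x⊆v ⟩
  length v + cyclicRises x  ≡⟨ cong (_+ cyclicRises x) (trans |v|≡n (sym |u|≡n)) ⟩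
  length u + cyclicRises x  ≡⟨ thin-cyclicRises u ⟩
  length x + cyclicRises u  ∎)
  where
  open ≤-Reasoning
  x = thin u
  x-short : 4 * length x ≤ 3 * n + 16
  x-short = thin-short (length x) (cyclicRises u) n
    (subst (λ m → 2 * length x + 4 * cyclicRises u ≤ 3 * m + 3) |u|≡n (thin-length u)) (≰⇒> long)
  x⊆v : CycSubword x v
  x⊆v = SameShortSubwords⇒⊆ {n} same x x-short (⊆⇒CycSubword (thin-⊆ u))

proposition2 : (n : ℕ) (u v : List Bool) → length u ≡ n → length v ≡ n →
    SameShortSubwords n u v →
    (n0 v ≡ n0 u) × (n1 v ≡ n1 u) × (blocks v ≡ blocks u)
proposition2 n u v |u|≡n |v|≡n same =
  ≡-via n0≡occ (occ-≡ false) , ≡-via n1≡occ (occ-≡ true) , ≡-via blocks≡cyclicRises cyclicRises-≡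
  where
  same′ = SameShortSubwords-sym {n} {u} {v} same
  occ-≡ : ∀ b → occ b v ≡ occ b u
  occ-≡ b = ≤-antisym (occ-≤ b {n} |u|≡n |v|≡n same) (occ-≤ b {n} |v|≡n |u|≡n same′)
  cyclicRises-≡ : cyclicRises v ≡ cyclicRises u
  cyclicRises-≡ = ≤-antisym (cyclicRises-≤ {n} |u|≡n |v|≡n same) (cyclicRises-≤ {n} |v|≡n |u|≡n same′)
  ≡-via : {f g : List Bool → ℕ} → (∀ w → f w ≡ g w) → g v ≡ g u → f v ≡ f u
  ≡-via f≗g eq = trans (f≗g v) (trans eq (sym (f≗g u)))
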